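{- The proof system $\mathbb{SKHM}$ is sound with respect to the class of all models: every formula derivable in $\mathbb{SKHM}$ is true at every state of every model.
   Context: Fix a countable set $\mathbf{P}$ of proposition letters and a countable non-empty set $\Sigma$ of action symbols. Formulas: $\phi::=p\mid\neg\phi\mid(\phi\wedge\phi)\mid \mathcal{K}hm(\phi,\phi,\phi)$ with $p\in\mathbf{P}$; $\top,\bot,\vee,\to$ are the usual abbreviations, and $\mathcal{U}\phi$ abbreviates $\mathcal{K}hm(\neg\phi,\top,\bot)$. A model is $\mathcal{M}=(S,R,V)$ with $S\neq\emptyset$, $R:\Sigma\to 2^{S\times S}$, $V:S\to 2^{\mathbf{P}}$; write $s\xrightarrow{a}t$ for $(s,t)\in R(a)$. For $\sigma=a_1\cdots a_n\in\Sigma^*$, $s\xrightarrow{\sigma}t$ means there are $s_2,\dots,s_n$ with $s\xrightarrow{a_1}s_2\cdots s_n\xrightarrow{a_n}t$ ($s\xrightarrow{\epsilon}s$ for the empty sequence). $\sigma_k=a_1\cdots a_k$, $\sigma_0=\epsilon$. $\sigma$ is strongly $\chi$-executable at $s'$ if for each $0\le k<n$ every $t$ with $s'\xrightarrow{\sigma_k}t$ has an $a_{k+1}$-successor, and $s'\xrightarrow{\sigma_k}t$ implies $\mathcal{M},t\vDash\chi$ for all $0<k<n$. Semantics: $\mathcal{M},s\vDash p$ iff $p\in V(s)$; Boolean clauses as usual; $\mathcal{M},s\vDash\mathcal{K}hm(\psi,\chi,\phi)$ iff there is $\sigma\in\Sigma^*$ such that for every $s'$ with $\mathcal{M},s'\vDash\psi$,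 $\sigma$ is strongly $\chi$-executable at $s'$ and $\mathcal{M},t\vDash\phi$ for all $t$ with $s'\xrightarrow{\sigma}t$. The system $\mathbb{SKHM}$ (with $p,q,r,o,p',q',o'$ proposition letters) has axioms: TAUT all propositional tautologies; DISTU $\mathcal{U}p\wedge\mathcal{U}(p\to q)\to\mathcal{U}q$; TU $\mathcal{U}p\to p$; 4KhmU $\mathcal{K}hm(p,o,q)\to\mathcal{U}\mathcal{K}hm(p,o,q)$; 5KhmU $\neg\mathcal{K}hm(p,o,q)\to\mathcal{U}\neg\mathcal{K}hm(p,o,q)$; EMPKhm $\mathcal{U}(p\to q)\to\mathcal{K}hm(p,\bot,q)$; COMPKhm $\mathcal{K}hm(p,o,r)\wedge\mathcal{K}hm(r,o,q)\wedge\mathcal{U}(r\to o)\to\mathcal{K}hm(p,o,q)$; ONEKhm $\mathcal{K}hm(p,o,q)\wedge\neg\mathcal{K}hm(p,\bot,q)\to\mathcal{K}hm(p,\bot,o)$; UKhm $\mathcal{U}(p'\to p)\wedge\mathcal{U}(o\to o')\wedge\mathcal{U}(q\to q')\wedge\mathcal{K}hm(p,o,q)\to\mathcal{K}hm(p',o',q')$; and rules MP (from $\varphi$ and $\varphi\to\psi$ infer $\psi$), NECU (from $\varphi$ infer $\mathcal{U}\varphi$), SUB (from $\varphi(p)$ infer $\varphi[\psi/p]$, uniform substitution). -}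

module Defs where

open import Data.Nat using (ℕ)
open import Data.List using (List; []; _∷_; length; take)
open import Data.Product using (Σ; ∃; _×_; _,_)
open import Data.Empty using (⊥)
open import Data.Unit using (⊤)
open import Relation.Nullary using (¬_; Dec)
open import Relation.Binary.PropositionalEquality using (_≡_)
open import Function using (Surjective)

-- Proposition letters: ℕ (countable).  Action symbols: any type with an
-- element and a surjection from ℕ (countable, non-empty).
Prop : Set
Prop = ℕ

record ActionSet : Set₁ where
  field
    Act       : Set
    someAct   : Act
    enum      : ℕ → Act
    enum-surj : Surjective _≡_ _≡_ enum

module Logic (A : ActionSet) where
  open ActionSet A

  infixr 6 _∧_
  data Form : Set where
    var  : Prop → Form
    ¬f   : Form → Form
    _∧_  : Form → Form → Form
    Khm  : Form → Form → Form → Form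

  ⊤f : Form
  ⊤f = ¬f (var 0 ∧ ¬f (var 0))

  ⊥f : Form
  ⊥f = ¬f ⊤f

  _∨f_ : Form → Form → Form
  φ ∨f ψ = ¬f (¬f φ ∧ ¬f ψ)

  _⇒_ : Form → Form → Form
  φ ⇒ ψ = ¬f (φ ∧ ¬f ψ)
  infixr 4 _⇒_

  U : Form → Form
  U φ = Khm (¬f φ) ⊤f ⊥f

  open import Data.Nat using (_≟_)
  open import Relation.Nullary using (yes; no)

  _[_/_] : Form → Form → Prop → Form
  var q   [ ψ / p ] with q ≟ p
  ... | yes _ = ψ
  ... | no  _ = var q
  ¬f φ    [ ψ / p ] = ¬f (φ [ ψ / p ])
  (φ ∧ χ) [ ψ / p ] = (φ [ ψ / p ]) ∧ (χ [ ψ / p ])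
  Khm a b c [ ψ / p ] = Khm (a [ ψ / p ]) (b [ ψ / p ]) (c [ ψ / p ])

  -- A tautology: true under every Boolean valuation of the letters and of the
  -- Khm-subformulas (treated as propositional atoms).
  open import Data.Bool using (Bool; true; false; not)
  import Data.Bool
  evalB : (Prop → Bool) → (Form → Form → Form → Bool) → Form → Bool
  evalB v k (var p)     = v p
  evalB v k (¬f φ)      = not (evalB v k φ)
  evalB v k (φ ∧ ψ)     = evalB v k φ Data.Bool.∧ evalB v k ψ
  evalB v k (Khm a b c) = k a b c

  Tautology : Form → Set
  Tautology φ = ∀ v k → evalB v k φ ≡ true

  p q r o p' q' o' : Form
  p = var 0 ; q = var 1 ; r = var 2 ; o = var 3
  p' = var 4 ; q' = var 5 ; o' = var 6

  data ⊢_ : Form → Set where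
    TAUT    : ∀ {φ} → Tautology φ → ⊢ φ
    DISTU   : ⊢ (U p ∧ U (p ⇒ q) ⇒ U q)
    TU      : ⊢ (U p ⇒ p)
    4KhmU   : ⊢ (Khm p o q ⇒ U (Khm p o q))
    5KhmU   : ⊢ (¬f (Khm p o q) ⇒ U (¬f (Khm p o q)))
    EMPKhm  : ⊢ (U (p ⇒ q) ⇒ Khm p ⊥f q)
    COMPKhm : ⊢ (Khm p o r ∧ Khm r o q ∧ U (r ⇒ o) ⇒ Khm p o q)
    ONEKhm  : ⊢ (Khm p o q ∧ ¬f (Khm p ⊥f q) ⇒ Khm p ⊥f o)
    UKhm    : ⊢ (U (p' ⇒ p) ∧ U (o ⇒ o') ∧ U (q ⇒ q') ∧ Khm p o q ⇒ Khm p' o' q')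
    MP      : ∀ {φ ψ} → ⊢ φ → ⊢ (φ ⇒ ψ) → ⊢ ψ
    NECU    : ∀ {φ} → ⊢ φ → ⊢ U φ
    SUB     : ∀ {φ} (ψ : Form) (x : Prop) → ⊢ φ → ⊢ (φ [ ψ / x ])

  record Model : Set₁ where
    field
      S    : Set
      s₀   : S               -- S ≠ ∅
      R    : Act → S → S → Set
      V    : S → Prop → Set

  module _ (M : Model) where
    open Model M

    Path : List Act → S → S → Set
    Path []      s t = s ≡ t
    Path (a ∷ σ) s t = Σ S λ u → R a s u × Path σ u t

    -- strong χ-executability of σ at s', with χ given as a predicate
    -- For σ = a₁⋯aₙ: every σ_k-successor t (0 ≤ k < n) has an a_{k+1}
    -- successor, and every σ_k-successor (0 < k < n) satisfies χ.
    SE : (S → Set) → List Act → S → Set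
    SE χ []      s = ⊤
    SE χ (a ∷ σ) s = (Σ S λ u → R a s u) × (∀ u → R a s u → NonEmpty σ u)
      where
      NonEmpty : List Act → S → Set
      NonEmpty []      u = ⊤
      NonEmpty (b ∷ τ) u = χ u × SE χ (b ∷ τ) u

    infix 3 _⊨_
    _⊨_ : S → Form → Set
    s ⊨ var x     = V s x
    s ⊨ ¬f φ      = ¬ (s ⊨ φ)
    s ⊨ (φ ∧ ψ)   = (s ⊨ φ) × (s ⊨ ψ)
    s ⊨ Khm ψ χ φ = Σ (List Act) λ σ → ∀ s' → s' ⊨ ψ →
                      SE (λ t → t ⊨ χ) σ s' × (∀ t → Path σ s' t → t ⊨ φ)

-- classical metatheory (the paper's): excluded middle for all of Set
ExcludedMiddle : Set₁
ExcludedMiddle = (A : Set) → Dec A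

-- The truth of
-- Khm φ χ ψ does not depend on the state, which validates 4KhmU and 5KhmU, and
-- U φ holds iff φ holds everywhere: a plan ending in ⊥f from a state must fail to be
-- strongly executable there, since strongly executable plans always reach some state.
-- COMPKhm concatenates plans, ONEKhm truncates a plan to its first action, and UKhm
-- is monotonicity. SUB is sound because φ [ ψ / x ] holds in a model exactly where
-- φ holds after revaluing x as the extension of ψ, and Khm only sees the transitions.
module Submission where

open import Defs
open import Data.Nat using (_≟_)
open import Data.List using (List; []; _∷_; _++_)
open import Data.Product using (Σ; ∃; _×_; _,_; proj₁; proj₂)
open import Data.Empty using (⊥-elim)
open import Data.Unit using (tt)
open import Relation.Nullary using (¬_; yes; no; does; proof)
open import Relation.Nullary.Reflects using (Reflects; invert; ¬-reflects; _×-reflects_)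
open import Relation.Nullary.Decidable using (decidable-stable)
open import Relation.Binary.PropositionalEquality using (refl; subst)

module Soundness (A : ActionSet) where
  open ActionSet A
  open Logic A

  module Frame (M : Model) where
    open Model M

    Path-++⁻ : ∀ σ τ {s t} → Path M (σ ++ τ) s t → ∃ λ m → Path M σ s m × Path M τ m t
    Path-++⁻ []      τ {s} p = s , refl , p
    Path-++⁻ (a ∷ σ) τ (u , r , p) with Path-++⁻ σ τ p
    ... | m , p₁ , p₂ = m , (u , r , p₁) , p₂

    SE-++ : ∀ (χ : S → Set) σ τ {s} → SE M χ σ s →
            (∀ t → Path M σ s t → χ t × SE M χ τ t) → SE M χ (σ ++ τ) s
    SE-++ χ []          τ     _       h = proj₂ (h _ refl)
    SE-++ χ (a ∷ [])    []    (e , _) h = e , λ _ _ → tt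
    SE-++ χ (a ∷ [])    (b ∷ τ) (e , _) h = e , λ u r → h u (u , r , refl)
    SE-++ χ (a ∷ b ∷ σ) τ     (e , f) h =
      e , λ u r → proj₁ (f u r) , SE-++ χ (b ∷ σ) τ (proj₂ (f u r)) (λ t p → h t (u , r , p))

    SE-endpoint : ∀ (χ : S → Set) σ {s} → SE M χ σ s → ∃ λ t → Path M σ s t
    SE-endpoint χ []          {s} _              = s , refl
    SE-endpoint χ (a ∷ [])        ((u , r) , _) = u , u , r , refl
    SE-endpoint χ (a ∷ b ∷ σ)     ((u , r) , f) with SE-endpoint χ (b ∷ σ) (proj₂ (f u r))
    ... | t , p = t , u , r , p

  open Frame

  -- With W = Model.V M the model revalue M W is M up to eta, so SE-revalue is then
  -- plain monotonicity of strong executability in χ.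
  revalue : (M : Model) → (Model.S M → Prop → Set) → Model
  revalue M W = record M { V = W }

  Path-revalue : ∀ M W σ {s t} → Path M σ s t → Path (revalue M W) σ s t
  Path-revalue M W []      e           = e
  Path-revalue M W (a ∷ σ) (u , r , p) = u , r , Path-revalue M W σ p

  SE-revalue : ∀ M W {χ χ' : Model.S M → Set} → (∀ t → χ t → χ' t) →
               ∀ σ {s} → SE M χ σ s → SE (revalue M W) χ' σ s
  SE-revalue M W g []          _       = tt
  SE-revalue M W g (a ∷ [])    (e , _) = e , λ _ _ → tt
  SE-revalue M W g (a ∷ b ∷ σ) (e , f) =
    e , λ u r → g u (proj₁ (f u r)) , SE-revalue M W g (b ∷ σ) (proj₂ (f u r))

  module InModel (M : Model) where
    open Model M

    infix 3 _⊩_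
    _⊩_ : S → Form → Set
    _⊩_ = _⊨_ M

    ⊩⊤f : ∀ {s} → s ⊩ ⊤f
    ⊩⊤f (v , ¬v) = ¬v v

    ⊮⊥f : ∀ {s} → ¬ (s ⊩ ⊥f)
    ⊮⊥f h = h ⊩⊤f

    ⇒-intro : ∀ s φ ψ → (s ⊩ φ → s ⊩ ψ) → s ⊩ φ ⇒ ψ
    ⇒-intro _ _ _ f (x , ¬y) = ¬y (f x)

    -- The truth of Khm φ χ ψ does not depend on the state: s ⊩ Khm φ χ ψ unfolds to this.
    KnowsHow : Form → Form → Form → Set
    KnowsHow φ χ ψ = Σ (List Act) λ σ → ∀ s → s ⊩ φ →
                       SE M (_⊩ χ) σ s × (∀ t → Path M σ s t → t ⊩ ψ)

    U-intro : ∀ φ → (∀ t → t ⊩ φ) → KnowsHow (¬f φ) ⊤f ⊥f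
    U-intro _ h = [] , λ t ¬φ → ⊥-elim (¬φ (h t))

    Khm-empty : ∀ {φ ψ} → (∀ t → t ⊩ φ → t ⊩ ψ) → KnowsHow φ ⊥f ψ
    Khm-empty h = [] , λ { s x → tt , λ { _ refl → h s x } }

    Khm-compose : ∀ {φ χ ρ ψ} → KnowsHow φ χ ρ → KnowsHow ρ χ ψ →
                  (∀ t → t ⊩ ρ → t ⊩ χ) → KnowsHow φ χ ψ
    Khm-compose (σ , f) (τ , g) ρ⊆χ = σ ++ τ , λ s x →
      let (exec , reach) = f s x in
      SE-++ M _ σ τ exec (λ t p → ρ⊆χ t (reach t p) , proj₁ (g t (reach t p))) ,
      λ t p → let (m , p₁ , p₂) = Path-++⁻ M σ τ p in proj₂ (g m (reach m p₁)) t p₂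

    Khm-mono : ∀ {φ χ ψ φ' χ' ψ'} → (∀ t → t ⊩ φ' → t ⊩ φ) → (∀ t → t ⊩ χ → t ⊩ χ') →
               (∀ t → t ⊩ ψ → t ⊩ ψ') → KnowsHow φ χ ψ → KnowsHow φ' χ' ψ'
    Khm-mono φ'⊆φ χ⊆χ' ψ⊆ψ' (σ , f) = σ , λ s x →
      let (exec , reach) = f s (φ'⊆φ s x) in
      SE-revalue M V χ⊆χ' σ exec , λ t p → ψ⊆ψ' t (reach t p)

    -- A plan of length ≥ 2 already witnesses its first intermediate condition after
    -- one step; a shorter plan has no intermediate states and so proves Khm φ ⊥f ψ.
    Khm-one : ∀ {φ χ ψ} → KnowsHow φ χ ψ → ¬ KnowsHow φ ⊥f ψ → KnowsHow φ ⊥f χ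
    Khm-one ([] , f) ¬k = ⊥-elim (¬k ([] , λ s x → tt , proj₂ (f s x)))
    Khm-one (a ∷ [] , f) ¬k =
      ⊥-elim (¬k (a ∷ [] , λ s x → (proj₁ (proj₁ (f s x)) , λ _ _ → tt) , proj₂ (f s x)))
    Khm-one (a ∷ b ∷ σ , f) _ = a ∷ [] , λ s x →
      let ((e , next) , _) = f s x in
      (e , λ _ _ → tt) , λ { t (u , r , refl) → proj₁ (next u r) }

  _⟨_≔_⟩ : (M : Model) → Prop → Form → Model
  M ⟨ x ≔ ψ ⟩ = revalue M V'
    where
    V' : Model.S M → Prop → Set
    V' s y with y ≟ x
    ... | yes _ = _⊨_ M s ψ
    ... | no  _ = Model.V M s y

  ⊨-subst  : ∀ M ψ x φ {s} → _⊨_ M s (φ [ ψ / x ]) → _⊨_ (M ⟨ x ≔ ψ ⟩) s φ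
  ⊨-subst⁻ : ∀ M ψ x φ {s} → _⊨_ (M ⟨ x ≔ ψ ⟩) s φ → _⊨_ M s (φ [ ψ / x ])
  ⊨-subst M ψ x (var y) h with y ≟ x
  ... | yes _ = h
  ... | no  _ = h
  ⊨-subst M ψ x (¬f φ)   h         = λ h' → h (⊨-subst⁻ M ψ x φ h')
  ⊨-subst M ψ x (φ ∧ χ)  (h₁ , h₂) = ⊨-subst M ψ x φ h₁ , ⊨-subst M ψ x χ h₂
  ⊨-subst M ψ x (Khm φ χ θ) (σ , f) = σ , λ s' h →
    let (exec , reach) = f s' (⊨-subst⁻ M ψ x φ h) in
    SE-revalue M _ (λ t → ⊨-subst M ψ x χ) σ exec ,
    λ t p → ⊨-subst M ψ x θ (reach t (Path-revalue (M ⟨ x ≔ ψ ⟩) (Model.V M) σ p))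
  ⊨-subst⁻ M ψ x (var y) h with y ≟ x
  ... | yes _ = h
  ... | no  _ = h
  ⊨-subst⁻ M ψ x (¬f φ)   h         = λ h' → h (⊨-subst M ψ x φ h')
  ⊨-subst⁻ M ψ x (φ ∧ χ)  (h₁ , h₂) = ⊨-subst⁻ M ψ x φ h₁ , ⊨-subst⁻ M ψ x χ h₂
  ⊨-subst⁻ M ψ x (Khm φ χ θ) (σ , f) = σ , λ s' h →
    let (exec , reach) = f s' (⊨-subst M ψ x φ h) in
    SE-revalue (M ⟨ x ≔ ψ ⟩) (Model.V M) (λ t → ⊨-subst⁻ M ψ x χ) σ exec ,
    λ t p → ⊨-subst⁻ M ψ x θ (reach t (Path-revalue M _ σ p))

  module Classical (em : ExcludedMiddle) where

    module ClassicalInModel (M : Model) where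
      open Model M
      open InModel M public

      ⇒-elim : ∀ φ ψ {s} → s ⊩ φ ⇒ ψ → s ⊩ φ → s ⊩ ψ
      ⇒-elim _ ψ {s} h x = decidable-stable (em (s ⊩ ψ)) λ ¬y → h (x , ¬y)

      U-elim : ∀ {φ} → KnowsHow (¬f φ) ⊤f ⊥f → ∀ t → t ⊩ φ
      U-elim {φ} (σ , f) t = decidable-stable (em (t ⊩ φ)) λ ¬φ →
        let (exec , reach) = f t ¬φ
            (u , p) = SE-endpoint M _ σ exec
        in ⊮⊥f (reach u p)

      ⊩-reflects-evalB : ∀ s φ → Reflects (s ⊩ φ)
        (evalB (λ y → does (em (V s y))) (λ φ χ ψ → does (em (s ⊩ Khm φ χ ψ))) φ)
      ⊩-reflects-evalB s (var y)     = proof (em (V s y))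
      ⊩-reflects-evalB s (¬f φ)      = ¬-reflects (⊩-reflects-evalB s φ)
      ⊩-reflects-evalB s (φ ∧ ψ)     = ⊩-reflects-evalB s φ ×-reflects ⊩-reflects-evalB s ψ
      ⊩-reflects-evalB s (Khm φ χ ψ) = proof (em (s ⊩ Khm φ χ ψ))

      Tautology⇒⊩ : ∀ φ s → Tautology φ → s ⊩ φ
      Tautology⇒⊩ φ s taut = invert (subst (Reflects (s ⊩ φ)) (taut _ _) (⊩-reflects-evalB s φ))

      U⇒-elim : ∀ {φ ψ} → KnowsHow (¬f (φ ⇒ ψ)) ⊤f ⊥f → ∀ t → t ⊩ φ → t ⊩ ψ
      U⇒-elim {φ} {ψ} u t = ⇒-elim φ ψ (U-elim {φ ⇒ ψ} u t)

    sound : ∀ {φ} → ⊢ φ → ∀ M s → _⊨_ M s φ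
    sound (TAUT {φ} taut) M s = Tautology⇒⊩ φ s taut
      where open ClassicalInModel M
    sound DISTU M s = ⇒-intro s (U p ∧ U (p ⇒ q)) (U q) λ (up , up⇒q) →
      U-intro q λ t → U⇒-elim up⇒q t (U-elim up t)
      where open ClassicalInModel M
    sound TU M s = ⇒-intro s (U p) p λ up → U-elim up s
      where open ClassicalInModel M
    sound 4KhmU M s = ⇒-intro s (Khm p o q) (U (Khm p o q)) λ k →
      U-intro (Khm p o q) λ _ → k
      where open ClassicalInModel M
    sound 5KhmU M s = ⇒-intro s (¬f (Khm p o q)) (U (¬f (Khm p o q))) λ ¬k →
      U-intro (¬f (Khm p o q)) λ _ → ¬k
      where open ClassicalInModel M
    sound EMPKhm M s = ⇒-intro s (U (p ⇒ q)) (Khm p ⊥f q) λ u →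
      Khm-empty (U⇒-elim u)
      where open ClassicalInModel M
    sound COMPKhm M s = ⇒-intro s (Khm p o r ∧ Khm r o q ∧ U (r ⇒ o)) (Khm p o q)
      λ (k₁ , k₂ , u) → Khm-compose k₁ k₂ (U⇒-elim u)
      where open ClassicalInModel M
    sound ONEKhm M s = ⇒-intro s (Khm p o q ∧ ¬f (Khm p ⊥f q)) (Khm p ⊥f o)
      λ (k , ¬k) → Khm-one k ¬k
      where open ClassicalInModel M
    sound UKhm M s = ⇒-intro s (U (p' ⇒ p) ∧ U (o ⇒ o') ∧ U (q ⇒ q') ∧ Khm p o q) (Khm p' o' q')
      λ (u₁ , u₂ , u₃ , k) → Khm-mono (U⇒-elim u₁) (U⇒-elim u₂) (U⇒-elim u₃) k
      where open ClassicalInModel M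
    sound (MP {φ} {ψ} d₁ d₂) M s = ⇒-elim φ ψ (sound d₂ M s) (sound d₁ M s)
      where open ClassicalInModel M
    sound (NECU {φ} d) M s = U-intro φ λ t → sound d M t
      where open ClassicalInModel M
    sound (SUB {φ} ψ x d) M s = ⊨-subst⁻ M ψ x φ (sound d (M ⟨ x ≔ ψ ⟩) s)

theorem1 : ExcludedMiddle → (A : ActionSet) → let open Logic A in
    (φ : Form) → ⊢ φ → (M : Model) → (s : Model.S M) → _⊨_ M s φ
theorem1 em A φ ⊢φ = Soundness.Classical.sound A em ⊢φ
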